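{- Let $p\ge 5$ be a prime and let $n\in\mathbb{N}$ be not a power of $2$. Then $g_p(n)\le 2n$.
   Context: $\mathbb{N}=\{0,1,2,\dots\}$. For an integer $m\ge 2$, an $m$-product sequence is a finite sequence of integers $a_1\le a_2\le\dots\le a_t$ such that $\prod_{i=1}^t a_i=R^m$ for some $R\in\mathbb{N}$ and no integer appears more than $m-1$ times in the sequence. For $n\in\mathbb{N}$, $g_m(n)$ is the least integer $s$ such that there exists an $m$-product sequence $a_1\le\dots\le a_t$ with $a_1=n$ and $a_t=s$. -}

module Defs where

open import Data.Nat using (ℕ; _≤_; _<_; _^_)
open import Data.Integer as ℤ using (ℤ; +_)
open import Data.List using (List; []; _∷_; foldr; head; last; filter; length)
open import Data.Integer.Properties using (≤-totalOrder)
open import Data.List.Relation.Unary.Sorted.TotalOrder ≤-totalOrder using (Sorted)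
open import Data.List.Relation.Unary.All using (All)
open import Data.Maybe using (Maybe; just)
open import Data.Product using (Σ; ∃; _×_)
open import Relation.Binary.PropositionalEquality using (_≡_)
open import Data.Integer.Properties using (_≟_)

productℤ : List ℤ → ℤ
productℤ = foldr ℤ._*_ (+ 1)

record ProductSeq (m : ℕ) (as : List ℤ) : Set where
  field
    sorted    : Sorted as
    perfect   : ∃ λ (R : ℕ) → productℤ as ≡ + (R ^ m)
    fewCopies : All (λ x → length (filter (x ≟_) as) < m) as

Attained : ℕ → ℕ → ℤ → Set
Attained m n s = Σ (List ℤ) λ as → ProductSeq m as × head as ≡ just (+ n) × last as ≡ just s

IsG : ℕ → ℕ → ℤ → Set
IsG m n s = Attained m n s × (∀ s' → Attained m n s' → s ℤ.≤ s')

-- For n > 0 not a power of 2 there is a power 2^K with n < 2^K < 2n, and a sequence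
-- n^c, (inner terms of the form 3^a 2^b), (2n)^d with c + d = m has product
-- n^m 2^d · (inner terms), so only exponents of 3 and 2 have to be balanced.
-- If m ∤ K the single inner term 2^K does it with c = K mod m.  If m ∣ K, write
-- 2^K = 32P; the inner terms are chosen among 24P, 27P, 36P, 48P according to the
-- position of n in (16P, 32P).  Finally g_p(n) exists at all because, for a given
-- bound s, the candidate sequences from n to s form a finite, decidable family.
module Submission where

open import Defs
open import Data.Bool using (T)
open import Data.Integer as ℤ using (ℤ; +_; -[1+_]; +≤+; +<+; -<+)
import Data.Integer.Properties as ℤₚ
open import Data.Integer.Properties using (_≟_; ≤-totalOrder)
open import Data.List using (List; []; _∷_; _++_; [_]; replicate; filter; length; head; last; map)
open import Data.List.Properties using (filter-++; filter-all; filter-none; length-++; length-replicate; ++-identityʳ)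
open import Data.List.Relation.Unary.All as All using (All; []; _∷_)
open import Data.List.Relation.Unary.All.Properties using (++⁺; ++⁻ʳ; replicate⁺; map⁺)
open import Data.List.Relation.Unary.Linked as Linked using (Linked; []; [-]; _∷_)
open import Data.List.Relation.Unary.Linked.Properties using (Linked⇒All)
open import Data.List.Relation.Unary.Sorted.TotalOrder ≤-totalOrder using (Sorted; sorted?)
open import Data.Maybe using (just)
open import Data.Maybe.Properties using (≡-dec)
open import Data.Nat using (ℕ; zero; suc; _+_; _<ᵇ_; _∸_; _*_; _^_; _≤_; _<_; _<?_; _≤?_; z≤n; s≤s; z<s; NonZero; >-nonZero⁻¹)
open import Data.Nat.DivMod using (_%_; _/_; m≡m%n+[m/n]*n; m%n<n)
open import Data.Nat.Induction using (<-rec)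
open import Data.Nat.Primality using (Prime)
open import Data.Nat.Tactic.RingSolver using (solve-∀)
import Data.Nat.Properties as ℕₚ
open import Data.Product using (∃; ∃₂; _×_; _,_; proj₁; proj₂)
open import Function using (_∘_; _on_; id)
open import Relation.Binary.Definitions using (tri<; tri≈; tri>)
open import Relation.Binary.PropositionalEquality using (_≡_; _≢_; refl; sym; trans; cong; cong₂; subst; subst₂; module ≡-Reasoning)
open import Relation.Nullary using (Dec; yes; no; ¬_; contradiction)
open import Relation.Nullary.Decidable using (map′; _×-dec_)
open import Relation.Unary using (Decidable)

count : ℤ → List ℤ → ℕ
count x xs = length (filter (x ≟_) xs)

FewCopies : ℕ → List ℤ → Set
FewCopies m xs = All (λ x → count x xs < m) xs

count-++ : ∀ x xs ys → count x (xs ++ ys) ≡ count x xs + count x ys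
count-++ x xs ys = trans (cong length (filter-++ (x ≟_) xs ys)) (length-++ (filter (x ≟_) xs))

count-replicate : ∀ x c → count x (replicate c x) ≡ c
count-replicate x c = trans (cong length (filter-all (x ≟_) (replicate⁺ c refl))) (length-replicate c)

count-replicate-++ : ∀ x c ys → count x (replicate c x ++ ys) ≡ c + count x ys
count-replicate-++ x c ys = trans (count-++ x (replicate c x) ys) (cong (_+ count x ys) (count-replicate x c))

count-absent : ∀ x ys → All (x ≢_) ys → count x ys ≡ 0
count-absent x ys x∉ys = cong length (filter-none (x ≟_) x∉ys)

FewCopies-++⁻ʳ : ∀ {m} xs {ys} → FewCopies m (xs ++ ys) → FewCopies m ys
FewCopies-++⁻ʳ xs {ys} few = All.map bound (++⁻ʳ xs few)
  where
  bound : ∀ {x m} → count x (xs ++ ys) < m → count x ys < m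
  bound {x} = ℕₚ.≤-<-trans (subst (count x ys ≤_) (sym (count-++ x xs ys)) (ℕₚ.m≤n+m _ _))

Sorted-++⁻ʳ : ∀ xs {ys} → Sorted (xs ++ ys) → Sorted ys
Sorted-++⁻ʳ []       s = s
Sorted-++⁻ʳ (x ∷ xs) s = Sorted-++⁻ʳ xs (Linked.tail s)

Sorted-replicate-++ : ∀ c x {ys} → Sorted ys → All (x ℤ.≤_) ys → Sorted (replicate c x ++ ys)
Sorted-replicate-++ zero          x s x≤ys       = s
Sorted-replicate-++ (suc zero)    x [] []        = [-]
Sorted-replicate-++ (suc zero)    x s (x≤y ∷ _)  = x≤y ∷ s
Sorted-replicate-++ (suc (suc c)) x s x≤ys       = ℤₚ.≤-refl ∷ Sorted-replicate-++ (suc c) x s x≤ys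

head-least : ∀ {x xs} → Sorted (x ∷ xs) → All (x ℤ.≤_) (x ∷ xs)
head-least = Linked⇒All ℤₚ.≤-trans ℤₚ.≤-refl

last-greatest : ∀ {xs l} → Sorted xs → last xs ≡ just l → All (ℤ._≤ l) xs
last-greatest {x ∷ []}     _       refl = ℤₚ.≤-refl ∷ []
last-greatest {x ∷ y ∷ ys} (x≤y ∷ s) eq with last-greatest s eq
... | y≤l ∷ ys≤l = ℤₚ.≤-trans x≤y y≤l ∷ y≤l ∷ ys≤l

leading-run : ∀ a xs → Sorted xs → All (+ a ℤ.≤_) xs →
              ∃₂ λ c r → xs ≡ replicate c (+ a) ++ r × All (+ a ℤ.<_) r
leading-run a []       _ _ = 0 , [] , refl , []
leading-run a (x ∷ xs) s (a≤x ∷ a≤xs) with x ≟ + a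
... | yes refl =
  let c , r , eq , a<r = leading-run a xs (Linked.tail s) a≤xs in suc c , r , cong (+ a ∷_) eq , a<r
... | no x≢a = 0 , x ∷ xs , refl , All.map (ℤₚ.<-≤-trans a<x) (head-least s)
  where a<x = ℤₚ.≤∧≢⇒< a≤x (x≢a ∘ sym)

Between : ℕ → ℕ → ℤ → Set
Between a b x = + a ℤ.≤ x × x ℤ.≤ + b

attained-≥ : ∀ {m n s} → Attained m n s → + n ℤ.≤ s
attained-≥ (x ∷ xs , ps , refl , l) = All.head (last-greatest (ProductSeq.sorted ps) l)

module _ {P : ℕ → Set} (P? : Decidable P) where

  least-witness : ∀ b → P b → ∃ λ k → P k × (∀ {i} → P i → k ≤ i) × k ≤ b
  least-witness = <-rec (λ b → P b → LeastBelow b) step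
    where
    LeastBelow : ℕ → Set
    LeastBelow b = ∃ λ k → P k × (∀ {i} → P i → k ≤ i) × k ≤ b

    step : ∀ b → (∀ {i} → i < b → P i → LeastBelow i) → P b → LeastBelow b
    step b smaller Pb with ℕₚ.anyUpTo? P? b
    ... | yes (i , i<b , Pi) =
      let k , Pk , least , k≤i = smaller i<b Pi in k , Pk , least , ℕₚ.≤-trans k≤i (ℕₚ.<⇒≤ i<b)
    ... | no none = b , Pb , (λ {i} Pi → ℕₚ.≮⇒≥ λ i<b → none (i , i<b , Pi)) , ℕₚ.≤-refl

m≤m^n : ∀ R m .{{_ : NonZero m}} → R ≤ R ^ m
m≤m^n zero    (suc m) = z≤n
m≤m^n (suc R) (suc m) = ℕₚ.m≤m*n (suc R) (suc R ^ m) {{ℕₚ.m^n≢0 (suc R) m}}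

module _ (m : ℕ) .{{_ : NonZero m}} where

  data Staircase : ℕ → ℕ → List ℤ → Set where
    last-run : ∀ {a c} → c < m → Staircase a 0 (replicate c (+ a))
    run      : ∀ {a c d xs} → c < m → Staircase (suc a) d xs → Staircase a (suc d) (replicate c (+ a) ++ xs)

  staircase? : ∀ d a {Q : List ℤ → Set} → Decidable Q → Dec (∃ λ xs → Staircase a d xs × Q xs)
  staircase? zero a Q? = map′
    (λ (c , c<m , q) → _ , last-run c<m , q)
    (λ { (_ , last-run {c = c} c<m , q) → c , c<m , q })
    (ℕₚ.anyUpTo? (λ c → Q? (replicate c (+ a))) m)
  staircase? (suc d) a Q? = map′
    (λ (c , c<m , xs , st , q) → _ , run c<m st , q)
    (λ { (_ , run {c = c} {xs = xs} c<m st , q) → c , c<m , xs , st , q })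
    (ℕₚ.anyUpTo? (λ c → staircase? d (suc a) (λ xs → Q? (replicate c (+ a) ++ xs))) m)

  run-length< : ∀ a c r → FewCopies m (replicate c (+ a) ++ r) → c < m
  run-length< a zero    r _ = >-nonZero⁻¹ m
  run-length< a (suc c) r (few ∷ _) =
    ℕₚ.≤-<-trans (subst (suc c ≤_) (sym (count-replicate-++ (+ a) (suc c) r)) (ℕₚ.m≤m+n (suc c) _)) few

  staircase : ∀ d a xs → Sorted xs → All (Between a (a + d)) xs → FewCopies m xs → Staircase a d xs
  staircase d a xs s bounded few with leading-run a xs s (All.map proj₁ bounded)
  staircase zero a _ s bounded few | c , [] , refl , _ =
    subst (Staircase a 0) (sym (++-identityʳ _)) (last-run (run-length< a c [] few))
  staircase zero a _ s bounded few | c , x ∷ r , refl , a<x ∷ _ with ++⁻ʳ (replicate c (+ a)) bounded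
  ... | (_ , x≤a) ∷ _ = contradiction (subst (λ b → x ℤ.≤ + b) (ℕₚ.+-identityʳ a) x≤a) (ℤₚ.<⇒≱ a<x)
  staircase (suc d) a _ s bounded few | c , r , refl , a<r =
    run (run-length< a c r few)
        (staircase d (suc a) r (Sorted-++⁻ʳ (replicate c (+ a)) s)
          (All.zipWith narrow (a<r , ++⁻ʳ (replicate c (+ a)) bounded))
          (FewCopies-++⁻ʳ (replicate c (+ a)) few))
    where
    narrow : ∀ {x} → + a ℤ.< x × Between a (a + suc d) x → Between (suc a) (suc a + d) x
    narrow {x} (+<+ a<i , _ , i≤) = +≤+ a<i , subst (λ b → x ℤ.≤ + b) (ℕₚ.+-suc a d) i≤

  perfect-power? : ∀ z → Dec (∃ λ R → z ≡ + (R ^ m))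
  perfect-power? -[1+ _ ] = no λ ()
  perfect-power? (+ v) = map′
    (λ (R , _ , v≡R^m) → R , cong +_ v≡R^m)
    (λ (R , eq) → R , s≤s (subst (R ≤_) (sym (ℤₚ.+-injective eq)) (m≤m^n R m)) , ℤₚ.+-injective eq)
    (ℕₚ.anyUpTo? (λ R → v ℕₚ.≟ R ^ m) (suc v))

  productSeq? : ∀ xs → Dec (ProductSeq m xs)
  productSeq? xs = map′
    (λ (s , p , f) → record { sorted = s ; perfect = p ; fewCopies = f })
    (λ ps → ProductSeq.sorted ps , ProductSeq.perfect ps , ProductSeq.fewCopies ps)
    (sorted? ℤₚ._≤?_ xs ×-dec perfect-power? (productℤ xs) ×-dec All.all? (λ x → count x xs <? m) xs)

  AttainedBy : ℕ → ℤ → List ℤ → Set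
  AttainedBy n s xs = ProductSeq m xs × head xs ≡ just (+ n) × last xs ≡ just s

  attainedBy? : ∀ n s → Decidable (AttainedBy n s)
  attainedBy? n s xs =
    productSeq? xs ×-dec ≡-dec _≟_ (head xs) (just (+ n)) ×-dec ≡-dec _≟_ (last xs) (just s)

  attained? : ∀ n j → Dec (Attained m n (+ j))
  attained? n j with n ≤? j
  ... | no n≰j  = no (n≰j ∘ ℤₚ.drop‿+≤+ ∘ attained-≥)
  ... | yes n≤j = map′ (λ (xs , _ , by) → xs , by) (λ (xs , by) → xs , staircase-of xs by , by)
                    (staircase? (j ∸ n) n (attainedBy? n (+ j)))
    where
    staircase-of : ∀ xs → AttainedBy n (+ j) xs → Staircase n (j ∸ n) xs
    staircase-of (x ∷ xs) (ps , refl , l) =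
      staircase (j ∸ n) n (x ∷ xs) sorted (All.zipWith id (head-least sorted , below)) (ProductSeq.fewCopies ps)
      where
      sorted : Sorted (x ∷ xs)
      sorted = ProductSeq.sorted ps
      below : All (ℤ._≤ + (n + (j ∸ n))) (x ∷ xs)
      below = All.map (subst (λ b → _ ℤ.≤ + b) (sym (ℕₚ.m+[n∸m]≡n n≤j))) (last-greatest sorted l)

  least-attained : ∀ n j → Attained m n (+ j) → ∃ λ s → IsG m n s × s ℤ.≤ + j
  least-attained n j att with least-witness (attained? n) j att
  ... | k , att-k , least , k≤j = + k , (att-k , minimal) , +≤+ k≤j
    where
    minimal : ∀ s → Attained m n s → + k ℤ.≤ s
    minimal -[1+ _ ] att-s = contradiction (attained-≥ att-s) (ℤₚ.<⇒≱ -<+)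
    minimal (+ i)    att-i = +≤+ (least att-i)

runs : List (ℕ × ℕ) → List ℤ
runs []            = []
runs ((v , k) ∷ L) = replicate k (+ v) ++ runs L

runProduct : List (ℕ × ℕ) → ℕ
runProduct []            = 1
runProduct ((v , k) ∷ L) = v ^ k * runProduct L

Ascending : List (ℕ × ℕ) → Set
Ascending = Linked (_<_ on proj₁)

runs-above : ∀ {v k L} → Ascending ((v , k) ∷ L) → All (+ v ℤ.<_) (runs L)
runs-above {L = []}          [-]         = []
runs-above {L = (w , l) ∷ L} (v<w ∷ asc) =
  ++⁺ (replicate⁺ l (+<+ v<w)) (All.map (ℤₚ.<-trans (+<+ v<w)) (runs-above asc))

runs-sorted : ∀ {L} → Ascending L → Sorted (runs L)
runs-sorted {[]}          []  = []
runs-sorted {(v , k) ∷ L} asc =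
  Sorted-replicate-++ k (+ v) (runs-sorted (Linked.tail asc)) (All.map ℤₚ.<⇒≤ (runs-above asc))

runs-fewCopies : ∀ {m L} → Ascending L → All ((_< m) ∘ proj₂) L → FewCopies m (runs L)
runs-fewCopies {L = []}              _   _             = []
runs-fewCopies {m} {(v , k) ∷ L} asc (k<m ∷ ks<m) =
  ++⁺ (replicate⁺ k (subst (_< m) (sym count-v) k<m))
      (All.zipWith count-above (runs-above asc , runs-fewCopies (Linked.tail asc) ks<m))
  where
  count-v : count (+ v) (replicate k (+ v) ++ runs L) ≡ k
  count-v = trans (count-replicate-++ (+ v) k (runs L))
              (trans (cong (_+_ k) (count-absent (+ v) (runs L) (All.map ℤₚ.<⇒≢ (runs-above asc))))
                     (ℕₚ.+-identityʳ k))
  count-above : ∀ {x} → + v ℤ.< x × count x (runs L) < m → count x (replicate k (+ v) ++ runs L) < m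
  count-above {x} (v<x , few) = subst (_< m) (sym count-x) few
    where
    count-x : count x (replicate k (+ v) ++ runs L) ≡ count x (runs L)
    count-x = trans (count-++ x (replicate k (+ v)) (runs L))
                (cong (_+ count x (runs L)) (count-absent x (replicate k (+ v)) (replicate⁺ k (ℤₚ.<⇒≢ v<x ∘ sym))))

productℤ-++ : ∀ xs ys → productℤ (xs ++ ys) ≡ productℤ xs ℤ.* productℤ ys
productℤ-++ []       ys = sym (ℤₚ.*-identityˡ _)
productℤ-++ (x ∷ xs) ys = trans (cong (x ℤ.*_) (productℤ-++ xs ys)) (sym (ℤₚ.*-assoc x _ _))

productℤ-replicate : ∀ k v → productℤ (replicate k (+ v)) ≡ + (v ^ k)
productℤ-replicate zero    v = refl
productℤ-replicate (suc k) v = trans (cong (+ v ℤ.*_) (productℤ-replicate k v)) (sym (ℤₚ.pos-* v (v ^ k)))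

productℤ-runs : ∀ L → productℤ (runs L) ≡ + runProduct L
productℤ-runs []            = refl
productℤ-runs ((v , k) ∷ L) = begin
  productℤ (replicate k (+ v) ++ runs L)            ≡⟨ productℤ-++ (replicate k (+ v)) (runs L) ⟩
  productℤ (replicate k (+ v)) ℤ.* productℤ (runs L) ≡⟨ cong₂ ℤ._*_ (productℤ-replicate k v) (productℤ-runs L) ⟩
  + (v ^ k) ℤ.* + runProduct L                      ≡⟨ ℤₚ.pos-* (v ^ k) (runProduct L) ⟨
  + (v ^ k * runProduct L)                          ∎
  where open ≡-Reasoning

last-++ : ∀ (xs : List ℤ) {ys z} → last ys ≡ just z → last (xs ++ ys) ≡ just z
last-++ []           eq = eq
last-++ (x ∷ [])     {y ∷ ys} eq = eq
last-++ (x ∷ x′ ∷ xs) eq = last-++ (x′ ∷ xs) eq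

last-runs : ∀ L v k → last (runs (L ++ [ (v , suc k) ])) ≡ just (+ v)
last-runs []            v zero    = refl
last-runs []            v (suc k) = last-runs [] v k
last-runs ((w , l) ∷ L) v k       = last-++ (replicate l (+ w)) (last-runs L v k)

attained-runs : ∀ m n a L s b R →
  let blocks = (n , suc a) ∷ L ++ [ (s , suc b) ] in
  Ascending blocks → All ((_< m) ∘ proj₂) blocks → runProduct blocks ≡ R ^ m → Attained m n (+ s)
attained-runs m n a L s b R asc few perfect =
  runs blocks ,
  record { sorted = runs-sorted asc ; perfect = R , trans (productℤ-runs blocks) (cong +_ perfect)
         ; fewCopies = runs-fewCopies asc few } ,
  refl , last-runs ((n , suc a) ∷ L) s b
  where blocks = (n , suc a) ∷ L ++ [ (s , suc b) ]

*-interchange : ∀ w x y z → w * x * (y * z) ≡ w * y * (x * z)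
*-interchange = solve-∀

^-distribʳ-* : ∀ x y k → (x * y) ^ k ≡ x ^ k * y ^ k
^-distribʳ-* x y zero    = refl
^-distribʳ-* x y (suc k) = begin
  x * y * (x * y) ^ k       ≡⟨ cong (x * y *_) (^-distribʳ-* x y k) ⟩
  x * y * (x ^ k * y ^ k)   ≡⟨ *-interchange x y (x ^ k) (y ^ k) ⟩
  x * x ^ k * (y * y ^ k)   ∎
  where open ≡-Reasoning

runProduct-++ : ∀ L L′ → runProduct (L ++ L′) ≡ runProduct L * runProduct L′
runProduct-++ []            L′ = sym (ℕₚ.+-identityʳ _)
runProduct-++ ((v , k) ∷ L) L′ =
  trans (cong (v ^ k *_) (runProduct-++ L L′)) (sym (ℕₚ.*-assoc (v ^ k) _ _))

smooth : ℕ → ℕ → ℕ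
smooth a b = 3 ^ a * 2 ^ b

smoothRuns : List (ℕ × ℕ × ℕ) → List (ℕ × ℕ)
smoothRuns = map λ (a , b , k) → smooth a b , k

exponent₃ : List (ℕ × ℕ × ℕ) → ℕ
exponent₃ []                = 0
exponent₃ ((a , _ , k) ∷ M) = a * k + exponent₃ M

exponent₂ : List (ℕ × ℕ × ℕ) → ℕ
exponent₂ []                = 0
exponent₂ ((_ , b , k) ∷ M) = b * k + exponent₂ M

smooth-* : ∀ a b a′ b′ → smooth a b * smooth a′ b′ ≡ smooth (a + a′) (b + b′)
smooth-* a b a′ b′ = begin
  3 ^ a * 2 ^ b * (3 ^ a′ * 2 ^ b′)     ≡⟨ *-interchange (3 ^ a) (2 ^ b) (3 ^ a′) (2 ^ b′) ⟩
  3 ^ a * 3 ^ a′ * (2 ^ b * 2 ^ b′)     ≡⟨ cong₂ _*_ (ℕₚ.^-distribˡ-+-* 3 a a′) (ℕₚ.^-distribˡ-+-* 2 b b′) ⟨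
  3 ^ (a + a′) * 2 ^ (b + b′)           ∎
  where open ≡-Reasoning

smooth-^ : ∀ a b k → smooth a b ^ k ≡ smooth (a * k) (b * k)
smooth-^ a b k = trans (^-distribʳ-* (3 ^ a) (2 ^ b) k) (cong₂ _*_ (ℕₚ.^-*-assoc 3 a k) (ℕₚ.^-*-assoc 2 b k))

runProduct-smooth : ∀ M → runProduct (smoothRuns M) ≡ smooth (exponent₃ M) (exponent₂ M)
runProduct-smooth []                = refl
runProduct-smooth ((a , b , k) ∷ M) = begin
  smooth a b ^ k * runProduct (smoothRuns M)                    ≡⟨ cong₂ _*_ (smooth-^ a b k) (runProduct-smooth M) ⟩
  smooth (a * k) (b * k) * smooth (exponent₃ M) (exponent₂ M)   ≡⟨ smooth-* (a * k) (b * k) _ _ ⟩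
  smooth (a * k + exponent₃ M) (b * k + exponent₂ M)            ∎
  where open ≡-Reasoning

attained-double-via-smooth : ∀ m n c d M α β → suc c + suc d ≡ m →
  Ascending ((n , suc c) ∷ smoothRuns M ++ [ (2 * n , suc d) ]) →
  All ((_< m) ∘ proj₂ ∘ proj₂) M →
  exponent₃ M ≡ α * m → exponent₂ M + suc d ≡ β * m →
  Attained m n (+ (2 * n))
attained-double-via-smooth _ n c d M α β refl asc few e₃ e₂ =
  attained-runs m n c (smoothRuns M) (2 * n) d (smooth α β * n) asc
    (ℕₚ.m<m+n (suc c) z<s ∷ ++⁺ (map⁺ few) (ℕₚ.m<n+m (suc d) z<s ∷ [])) perfect
  where
  open ≡-Reasoning
  m = suc c + suc d
  E₃ = exponent₃ M
  E₂ = exponent₂ M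
  perfect : runProduct ((n , suc c) ∷ smoothRuns M ++ [ (2 * n , suc d) ]) ≡ (smooth α β * n) ^ m
  perfect = begin
    n ^ suc c * runProduct (smoothRuns M ++ [ (2 * n , suc d) ])
      ≡⟨ cong (n ^ suc c *_) (runProduct-++ (smoothRuns M) _) ⟩
    n ^ suc c * (runProduct (smoothRuns M) * ((2 * n) ^ suc d * 1))
      ≡⟨ cong₂ (λ x y → n ^ suc c * (x * (y * 1))) (runProduct-smooth M) (^-distribʳ-* 2 n (suc d)) ⟩
    n ^ suc c * (3 ^ E₃ * 2 ^ E₂ * (2 ^ suc d * n ^ suc d * 1))
      ≡⟨ regroup (n ^ suc c) (3 ^ E₃) (2 ^ E₂) (2 ^ suc d) (n ^ suc d) ⟩
    3 ^ E₃ * (2 ^ E₂ * 2 ^ suc d) * (n ^ suc c * n ^ suc d)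
      ≡⟨ cong₂ (λ x y → 3 ^ E₃ * x * y) (ℕₚ.^-distribˡ-+-* 2 E₂ (suc d)) (ℕₚ.^-distribˡ-+-* n (suc c) (suc d)) ⟨
    smooth E₃ (E₂ + suc d) * n ^ m
      ≡⟨ cong₂ (λ x y → smooth x y * n ^ m) e₃ e₂ ⟩
    smooth (α * m) (β * m) * n ^ m
      ≡⟨ cong (_* n ^ m) (smooth-^ α β m) ⟨
    smooth α β ^ m * n ^ m
      ≡⟨ ^-distribʳ-* (smooth α β) n m ⟨
    (smooth α β * n) ^ m
      ∎
    where
    regroup : ∀ a b c d e → a * (b * c * (d * e * 1)) ≡ b * (c * d) * (a * e)
    regroup = solve-∀

attained-double-off-multiple : ∀ m n K r s D → suc r + suc s ≡ m → K ≡ suc r + D * m →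
  n < 2 ^ K → 2 ^ K < 2 * n → Attained m n (+ (2 * n))
attained-double-off-multiple _ n _ r s D refl refl n<2^K 2^K<2n =
  attained-double-via-smooth m n r s [ (0 , K , 1) ] 0 (suc D) refl
    (subst (n <_) 2^K≡ n<2^K ∷ subst (_< 2 * n) 2^K≡ 2^K<2n ∷ [-])
    (ℕₚ.+-mono-≤ {1} {suc r} (s≤s z≤n) (s≤s z≤n) ∷ []) refl (exponents r s D)
  where
  m = suc r + suc s
  K = suc r + D * m
  2^K≡ : 2 ^ K ≡ smooth 0 K
  2^K≡ = sym (ℕₚ.*-identityˡ (2 ^ K))
  exponents : ∀ r s D → let m = suc r + suc s in (suc r + D * m) * 1 + 0 + suc s ≡ suc D * m
  exponents = solve-∀

module MultipleExponent (q u n : ℕ) where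

  m K j P : ℕ
  m = 5 + q
  K = suc u * m
  j = q + u * m
  P = 2 ^ j

  2^K≡32P : 2 ^ K ≡ 32 * P
  2^K≡32P = ℕₚ.^-distribˡ-+-* 2 5 j

  instance
    P-nonZero : NonZero P
    P-nonZero = ℕₚ.m^n≢0 2 j

  smooth-scaled : ∀ a b → smooth a (b + j) ≡ smooth a b * P
  smooth-scaled a b = trans (cong (3 ^ a *_) (ℕₚ.^-distribˡ-+-* 2 b j)) (sym (ℕₚ.*-assoc (3 ^ a) (2 ^ b) P))

  *P-< : ∀ a b → T (a <ᵇ b) → a * P < b * P
  *P-< a b a<b = ℕₚ.*-monoˡ-< P (ℕₚ.<ᵇ⇒< a b a<b)

  smooth-scaled-< : ∀ a b a′ b′ → T (smooth a b <ᵇ smooth a′ b′) → smooth a (b + j) < smooth a′ (b′ + j)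
  smooth-scaled-< a b a′ b′ lt =
    subst₂ _<_ (sym (smooth-scaled a b)) (sym (smooth-scaled a′ b′)) (*P-< (smooth a b) (smooth a′ b′) lt)

  n<smooth-scaled : ∀ a b → n < smooth a b * P → n < smooth a (b + j)
  n<smooth-scaled a b = subst (n <_) (sym (smooth-scaled a b))

  smooth-scaled<2n : ∀ a b → smooth a b * P < 2 * n → smooth a (b + j) < 2 * n
  smooth-scaled<2n a b = subst (_< 2 * n) (sym (smooth-scaled a b))

  doubled : ∀ a → a * P < n → (2 * a) * P < 2 * n
  doubled a lt = subst (_< 2 * n) (sym (ℕₚ.*-assoc 2 a P)) (ℕₚ.*-monoʳ-< 2 lt)

  const<m : ∀ i → T (i <ᵇ 5) → i < m
  const<m i i<5 = ℕₚ.<-≤-trans (ℕₚ.<ᵇ⇒< i 5 i<5) (ℕₚ.m≤m+n 5 q)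

  shifted<m : ∀ i → T (i <ᵇ 5) → i + q < m
  shifted<m i i<5 = ℕₚ.+-monoˡ-< q (ℕₚ.<ᵇ⇒< i 5 i<5)

  -- The exponent identities are stated in the unfolded form of exponent₃ and exponent₂
  -- of the inner runs, since the ring solver does not unfold definitions.
  low-range : n ≤ 18 * P → 32 * P < 2 * n → Attained m n (+ (2 * n))
  low-range n≤18P 32P<2n =
    attained-double-via-smooth m n 0 (3 + q) ((1 , 3 + j , 2 + q) ∷ (3 , j , 1) ∷ [])
      1 (2 + 3 * u + q + q * u) refl
      (n<smooth-scaled 1 3 (ℕₚ.≤-<-trans n≤18P (*P-< 18 24 _)) ∷
       smooth-scaled-< 1 3 3 0 _ ∷
       smooth-scaled<2n 3 0 (ℕₚ.<-trans (*P-< 27 32 _) 32P<2n) ∷ [-])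
      (shifted<m 2 _ ∷ const<m 1 _ ∷ []) (exponent₃≡ q) (exponent₂≡ q u)
    where
    exponent₃≡ : ∀ q → 1 * (2 + q) + (3 * 1 + 0) ≡ 1 * (5 + q)
    exponent₃≡ = solve-∀
    exponent₂≡ : ∀ q u → let j = q + u * (5 + q) in
      (3 + j) * (2 + q) + (j * 1 + 0) + (4 + q) ≡ (2 + 3 * u + q + q * u) * (5 + q)
    exponent₂≡ = solve-∀

  lower-middle-range : 18 * P < n → n < 24 * P → Attained m n (+ (2 * n))
  lower-middle-range 18P<n n<24P =
    attained-double-via-smooth m n 0 (3 + q) ((1 , 3 + j , 3 + q) ∷ (2 , 2 + j , 1) ∷ [])
      1 (3 + 4 * u + q + q * u) refl
      (n<smooth-scaled 1 3 n<24P ∷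
       smooth-scaled-< 1 3 2 2 _ ∷
       smooth-scaled<2n 2 2 (doubled 18 18P<n) ∷ [-])
      (shifted<m 3 _ ∷ const<m 1 _ ∷ []) (exponent₃≡ q) (exponent₂≡ q u)
    where
    exponent₃≡ : ∀ q → 1 * (3 + q) + (2 * 1 + 0) ≡ 1 * (5 + q)
    exponent₃≡ = solve-∀
    exponent₂≡ : ∀ q u → let j = q + u * (5 + q) in
      (3 + j) * (3 + q) + ((2 + j) * 1 + 0) + (4 + q) ≡ (3 + 4 * u + q + q * u) * (5 + q)
    exponent₂≡ = solve-∀

  middle-point : n ≡ 24 * P → Attained m n (+ (2 * n))
  middle-point n≡24P =
    attained-double-via-smooth m n (3 + q) 0 ((3 , j , 2) ∷ (2 , 2 + j , 2 + q) ∷ [])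
      2 (1 + 4 * u + q + q * u) (ℕₚ.+-comm (4 + q) 1)
      (n<smooth-scaled 3 0 (subst (_< 27 * P) (sym n≡24P) (*P-< 24 27 _)) ∷
       smooth-scaled-< 3 0 2 2 _ ∷
       smooth-scaled<2n 2 2 (subst (36 * P <_) (sym 2n≡48P) (*P-< 36 48 _)) ∷ [-])
      (const<m 2 _ ∷ shifted<m 2 _ ∷ []) (exponent₃≡ q) (exponent₂≡ q u)
    where
    2n≡48P : 2 * n ≡ 48 * P
    2n≡48P = trans (cong (2 *_) n≡24P) (sym (ℕₚ.*-assoc 2 24 P))
    exponent₃≡ : ∀ q → 3 * 2 + (2 * (2 + q) + 0) ≡ 2 * (5 + q)
    exponent₃≡ = solve-∀
    exponent₂≡ : ∀ q u → let j = q + u * (5 + q) in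
      j * 2 + ((2 + j) * (2 + q) + 0) + 1 ≡ (1 + 4 * u + q + q * u) * (5 + q)
    exponent₂≡ = solve-∀

  upper-range : 24 * P < n → n < 32 * P → Attained m n (+ (2 * n))
  upper-range 24P<n n<32P =
    attained-double-via-smooth m n (3 + q) 0 ((2 , 2 + j , 1) ∷ (1 , 4 + j , 3 + q) ∷ [])
      1 (3 + 4 * u + q + q * u) (ℕₚ.+-comm (4 + q) 1)
      (n<smooth-scaled 2 2 (ℕₚ.<-trans n<32P (*P-< 32 36 _)) ∷
       smooth-scaled-< 2 2 1 4 _ ∷
       smooth-scaled<2n 1 4 (doubled 24 24P<n) ∷ [-])
      (const<m 1 _ ∷ shifted<m 3 _ ∷ []) (exponent₃≡ q) (exponent₂≡ q u)
    where
    exponent₃≡ : ∀ q → 2 * 1 + (1 * (3 + q) + 0) ≡ 1 * (5 + q)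
    exponent₃≡ = solve-∀
    exponent₂≡ : ∀ q u → let j = q + u * (5 + q) in
      (2 + j) * 1 + ((4 + j) * (3 + q) + 0) + 1 ≡ (3 + 4 * u + q + q * u) * (5 + q)
    exponent₂≡ = solve-∀

  attained-double-on-multiple : n < 2 ^ K → 2 ^ K < 2 * n → Attained m n (+ (2 * n))
  attained-double-on-multiple n<2^K 2^K<2n with n ≤? 18 * P | ℕₚ.<-cmp n (24 * P)
  ... | yes n≤18P | _          = low-range n≤18P (subst (_< 2 * n) 2^K≡32P 2^K<2n)
  ... | no  n≰18P | tri< lt _ _ = lower-middle-range (ℕₚ.≰⇒> n≰18P) lt
  ... | no  _     | tri≈ _ eq _ = middle-point eq
  ... | no  _     | tri> _ _ gt = upper-range gt (subst (n <_) 2^K≡32P n<2^K)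

attained-double-via-power-of-two : ∀ q n K → 0 < n → n < 2 ^ K → 2 ^ K < 2 * n →
                                   Attained (5 + q) n (+ (2 * n))
attained-double-via-power-of-two q n K 0<n n<2^K 2^K<2n =
  by-residue (K % m) (K / m) (m≡m%n+[m/n]*n K m) (m%n<n K m)
  where
  m = 5 + q
  by-residue : ∀ r D → K ≡ r + D * m → r < m → Attained m n (+ (2 * n))
  by-residue zero    zero    refl _   = contradiction n<2^K (ℕₚ.<⇒≱ 0<n ∘ ℕₚ.≤-pred)
  by-residue zero    (suc u) refl _   = MultipleExponent.attained-double-on-multiple q u n n<2^K 2^K<2n
  by-residue (suc r) D       K≡ r<m =
    let s , r+s≡m = ℕₚ.m≤n⇒∃[o]m+o≡n r<m
    in attained-double-off-multiple m n K r s D (trans (ℕₚ.+-suc (suc r) s) r+s≡m) K≡ n<2^K 2^K<2n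

power-of-two-bracket : ∀ n → 0 < n → ∃ λ k → 2 ^ k ≤ n × n < 2 ^ suc k
power-of-two-bracket (suc zero)    _ = 0 , ℕₚ.≤-refl , ℕₚ.<ᵇ⇒< 1 2 _
power-of-two-bracket (suc (suc n)) _ with power-of-two-bracket (suc n) z<s
... | k , 2^k≤ , <2^[1+k] with suc (suc n) <? 2 ^ suc k
...   | yes lt  = k , ℕₚ.m≤n⇒m≤1+n 2^k≤ , lt
...   | no  ≮   =
  suc k , ℕₚ.≮⇒≥ ≮ , ℕₚ.≤-<-trans <2^[1+k] (ℕₚ.^-monoʳ-< 2 (ℕₚ.<ᵇ⇒< 1 2 _) (ℕₚ.n<1+n (suc k)))

power-of-two-between : ∀ n → 0 < n → ¬ (∃ λ k → n ≡ 2 ^ k) → ∃ λ K → n < 2 ^ K × 2 ^ K < 2 * n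
power-of-two-between n 0<n n≢2^k with power-of-two-bracket n 0<n
... | k , 2^k≤n , n<2^[1+k] =
  suc k , n<2^[1+k] , ℕₚ.*-monoʳ-< 2 (ℕₚ.≤∧≢⇒< 2^k≤n (λ eq → n≢2^k (k , sym eq)))

attained-double-of-non-power-of-two : ∀ q n → ¬ (∃ λ k → n ≡ 2 ^ k) → Attained (5 + q) n (+ (2 * n))
attained-double-of-non-power-of-two q zero    _       =
  + 0 ∷ [] , record { sorted = [-] ; perfect = 0 , refl ; fewCopies = s≤s (s≤s z≤n) ∷ [] } , refl , refl
attained-double-of-non-power-of-two q (suc n) n≢2^k =
  let K , n<2^K , 2^K<2n = power-of-two-between (suc n) z<s n≢2^k
  in attained-double-via-power-of-two q (suc n) K z<s n<2^K 2^K<2n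

lemma4p8 : (p n : ℕ) → Prime p → 5 ≤ p → ¬ (∃ λ k → n ≡ 2 ^ k)
         → ∃ λ (s : ℤ) → IsG p n s × s ℤ.≤ + (2 * n)
lemma4p8 p n _ 5≤p n≢2^k with ℕₚ.m≤n⇒∃[o]m+o≡n 5≤p
... | q , refl = least-attained (5 + q) n (2 * n) (attained-double-of-non-power-of-two q n n≢2^k)
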